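{- For every non-negative integer $n$, $$(-432)^n\sum_{k=0}^n\left(\frac{(1/6)_k(5/6)_{n-k}}{(1)_k(1)_{n-k}}\right)^2=\sum_{k=0}^n\binom{6k}{3k}\binom{3k}{2k}\binom{2k}{k}\binom{n+k}{n-k}(-432)^{n-k}.$$
   Context: $(\alpha)_n=\alpha(\alpha+1)\cdots(\alpha+n-1)$ denotes the Pochhammer symbol, with $(\alpha)_0=1$. -}

module Defs where

open import Data.Nat using (ℕ; zero; suc; _∸_)
open import Data.Rational using (ℚ; 0ℚ; 1ℚ; _+_; _*_; -_; _/_; 1/_; ≢-nonZero)
open import Data.Rational.Properties using (_≟_)
open import Relation.Nullary using (yes; no)
import Data.Integer as ℤ

poch : ℚ → ℕ → ℚ
poch α zero    = 1ℚ
poch α (suc n) = poch α n * (α + ℤ.+ n / 1)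

-- Total division on ℚ (x ÷ 0 := 0); only ever used with non-zero divisors here
infixl 7 _÷'_
_÷'_ : ℚ → ℚ → ℚ
p ÷' q with q ≟ 0ℚ
... | yes _  = 0ℚ
... | no q≢0 = p * (1/_ q {{≢-nonZero q≢0}})

sumTo : ℕ → (ℕ → ℚ) → ℚ
sumTo zero    f = f 0
sumTo (suc n) f = sumTo n f + f (suc n)

ℕ→ℚ : ℕ → ℚ
ℕ→ℚ m = ℤ.+ m / 1

m432 : ℚ
m432 = - ℕ→ℚ 432

infixr 8 _^ℚ_
_^ℚ_ : ℚ → ℕ → ℚ
p ^ℚ zero  = 1ℚ
p ^ℚ suc n = p * p ^ℚ n

{-# OPTIONS --safe #-}
module Submission where

-- Both sides, as sequences in n, are annihilated by the same recurrence
--   y²(n+1)³ xₙ + 24(2n+3)(18n²+54n+49) xₙ₊₁ + (n+2)³ xₙ₊₂ = 0,   y = -432,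
-- and they agree for n = 0, 1; as (n+2)³ never vanishes, they agree everywhere.
-- Each recurrence comes from creative telescoping: for the summand F(n, k) (on the
-- left with yⁿ moved inside the sum) an explicit certificate G(n, k) satisfies
--   Σᵢ rᵢ(n) F(n+i, k) = G(n, k+1) - G(n, k),
-- which follows from the first-order ratios of F in n and in k.  Summing over k
-- telescopes to zero.  The ratios come from the factorial formula for binomial
-- coefficients on the right and from the recursion of the Pochhammer symbol on the left.

open import Defs
open import Agda.Builtin.FromNat using (fromNat)
open import Data.Unit.Base using (tt)
import Data.Nat.Literals as ℕ
import Data.Rational.Literals as ℚ

instance
  ℕ-number = ℕ.number
  ℚ-number = ℚ.number
  literal-constraint = tt

-- Binomial coefficients

module Binomial where

  open import Data.Nat
  open import Data.Nat.Properties
  open import Data.Nat.Combinatorics using (_C_; nCk≡n!/k![n-k]!; k![n∸k]!∣n!)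
  open import Data.Nat.DivMod using (m/n*n≡m)
  open import Data.Nat.Tactic.RingSolver using (solve-∀)
  open import Relation.Binary.PropositionalEquality
  open ≡-Reasoning

  C-factorial : ∀ {n} m j → n ≡ m + j → (n C j) * (j ! * m !) ≡ n !
  C-factorial m j refl = begin
    ((m + j) C j) * (j ! * m !)                  ≡⟨ cong (λ i → ((m + j) C j) * (j ! * i !)) (sym (m+n∸n≡m m j)) ⟩
    ((m + j) C j) * (j ! * (m + j ∸ j) !)        ≡⟨ cong (_* (j ! * (m + j ∸ j) !)) (nCk≡n!/k![n-k]! j≤m+j) ⟩
    ((m + j) ! / (j ! * (m + j ∸ j) !)) * (j ! * (m + j ∸ j) !) ≡⟨ m/n*n≡m (k![n∸k]!∣n! j≤m+j) ⟩
    (m + j) !                                  ∎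
    where
    j≤m+j = m≤n+m j m
    instance _ = j !* (m + j ∸ j) !≢0

  C-suc-bottom : ∀ m j → suc j * ((m + suc j) C suc j) ≡ (m + suc j) * ((m + j) C j)
  C-suc-bottom m j = *-cancelʳ-≡ _ _ (j ! * m !) {{j !* m !≢0}} (begin
    suc j * ((m + suc j) C suc j) * (j ! * m !)   ≡⟨ shuffle (suc j) ((m + suc j) C suc j) (j !) (m !) ⟩
    ((m + suc j) C suc j) * (suc j ! * m !)       ≡⟨ C-factorial m (suc j) refl ⟩
    (m + suc j) !                               ≡⟨ cong _! (+-suc m j) ⟩
    suc (m + j) * (m + j) !                     ≡⟨ cong₂ (λ i c → i * c) (sym (+-suc m j)) (sym (C-factorial m j refl)) ⟩
    (m + suc j) * (((m + j) C j) * (j ! * m !))   ≡⟨ *-assoc (m + suc j) ((m + j) C j) (j ! * m !) ⟨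
    (m + suc j) * ((m + j) C j) * (j ! * m !)     ∎)
    where
    shuffle : ∀ s c f g → s * c * (f * g) ≡ c * (s * f * g)
    shuffle = solve-∀

  C-suc-top : ∀ m j → suc m * ((suc m + j) C j) ≡ (suc m + j) * ((m + j) C j)
  C-suc-top m j = *-cancelʳ-≡ _ _ (j ! * m !) {{j !* m !≢0}} (begin
    suc m * ((suc m + j) C j) * (j ! * m !)       ≡⟨ shuffle (suc m) ((suc m + j) C j) (j !) (m !) ⟩
    ((suc m + j) C j) * (j ! * suc m !)           ≡⟨ C-factorial (suc m) j refl ⟩
    (suc m + j) !                               ≡⟨ cong ((suc m + j) *_) (C-factorial m j refl) ⟨
    (suc m + j) * (((m + j) C j) * (j ! * m !))   ≡⟨ *-assoc (suc m + j) ((m + j) C j) (j ! * m !) ⟨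
    (suc m + j) * ((m + j) C j) * (j ! * m !)     ∎)
    where
    shuffle : ∀ s c f g → s * c * (f * g) ≡ c * (f * (s * g))
    shuffle = solve-∀

  binom₃ : ℕ → ℕ
  binom₃ k = ((6 * k) C (3 * k)) * ((3 * k) C (2 * k)) * ((2 * k) C k)

  binom₃-factorial : ∀ k → binom₃ k * ((3 * k) ! * (k ! * k ! * k !)) ≡ (6 * k) !
  binom₃-factorial k = *-cancelʳ-≡ _ _ ((2 * k) !) {{(2 * k) !≢0}} (begin
    X * Y * Z * ((3 * k) ! * (k ! * k ! * k !)) * (2 * k) !
      ≡⟨ regroup X Y Z ((3 * k) !) (k !) ((2 * k) !) ⟩
    X * (3 * k) ! * (Y * ((2 * k) ! * k !)) * (Z * (k ! * k !))
      ≡⟨ cong₂ (λ u v → X * (3 * k) ! * u * v) (C-factorial k (2 * k) refl) (C-factorial k k (cong (k +_) (+-identityʳ k))) ⟩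
    X * (3 * k) ! * (3 * k) ! * (2 * k) !
      ≡⟨ cong (_* (2 * k) !) (trans (*-assoc X ((3 * k) !) ((3 * k) !)) (C-factorial (3 * k) (3 * k) (six≡three+three k))) ⟩
    (6 * k) ! * (2 * k) ! ∎)
    where
    X = (6 * k) C (3 * k)
    Y = (3 * k) C (2 * k)
    Z = (2 * k) C k
    regroup : ∀ x y z a b c → x * y * z * (a * (b * b * b)) * c ≡ x * a * (y * (c * b)) * (z * (b * b))
    regroup = solve-∀
    six≡three+three : ∀ k → 6 * k ≡ 3 * k + 3 * k
    six≡three+three = solve-∀

  binom₃-suc : ∀ k → suc k * suc k * suc k * binom₃ (suc k) ≡ 8 * (6 * k + 1) * (6 * k + 3) * (6 * k + 5) * binom₃ k
  binom₃-suc k = *-cancelʳ-≡ _ _ (W (suc k)) {{W≢0 (suc k)}} (begin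
    s * s * s * binom₃ (suc k) * W (suc k)      ≡⟨ *-assoc (s * s * s) (binom₃ (suc k)) (W (suc k)) ⟩
    s * s * s * (binom₃ (suc k) * W (suc k))    ≡⟨ cong (s * s * s *_) (binom₃-factorial (suc k)) ⟩
    s * s * s * (6 * s) !                       ≡⟨ cong (λ i → s * s * s * i !) (six-suc k) ⟩
    s * s * s * (6 + 6 * k) !                   ≡⟨ falling-six k ((6 * k) !) ⟩
    R * ((3 + 3 * k) * (2 + 3 * k) * (1 + 3 * k) * (s * s * s) * (6 * k) !)
      ≡⟨ cong (λ f → R * ((3 + 3 * k) * (2 + 3 * k) * (1 + 3 * k) * (s * s * s) * f)) (binom₃-factorial k) ⟨
    R * ((3 + 3 * k) * (2 + 3 * k) * (1 + 3 * k) * (s * s * s) * (binom₃ k * W k))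
      ≡⟨ regroup R (3 * k) s (binom₃ k) (W k) ⟩
    R * binom₃ k * ((3 + 3 * k) * (2 + 3 * k) * (1 + 3 * k) * (s * s * s) * W k)
      ≡⟨ cong (R * binom₃ k *_) (W-suc k) ⟨
    R * binom₃ k * W (suc k)                    ∎)
    where
    s = suc k
    R = 8 * (6 * k + 1) * (6 * k + 3) * (6 * k + 5)
    W : ℕ → ℕ
    W j = (3 * j) ! * (j ! * j ! * j !)
    W≢0 : ∀ j → NonZero (W j)
    W≢0 j = m*n≢0 _ _ {{(3 * j) !≢0}} {{m*n≢0 _ _ {{m*n≢0 _ _ {{j !≢0}} {{j !≢0}}}} {{j !≢0}}}}
    six-suc : ∀ k → 6 * suc k ≡ 6 + 6 * k
    six-suc = solve-∀
    three-suc : ∀ k → 3 * suc k ≡ 3 + 3 * k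
    three-suc = solve-∀
    W-suc : ∀ j → W (suc j) ≡ (3 + 3 * j) * (2 + 3 * j) * (1 + 3 * j) * (suc j * suc j * suc j) * W j
    W-suc j = trans (cong (λ i → i ! * (suc j ! * suc j ! * suc j !)) (three-suc j)) (unfold j (3 * j) (j !) ((3 * j) !))
      where
      unfold : ∀ j t f g → (3 + t) * ((2 + t) * ((1 + t) * g)) * (suc j * f * (suc j * f) * (suc j * f))
                         ≡ (3 + t) * (2 + t) * (1 + t) * (suc j * suc j * suc j) * (g * (f * f * f))
      unfold = solve-∀
    falling-six : ∀ k f → suc k * suc k * suc k *
                    ((6 + 6 * k) * ((5 + 6 * k) * ((4 + 6 * k) * ((3 + 6 * k) * ((2 + 6 * k) * ((1 + 6 * k) * f))))))
                  ≡ 8 * (6 * k + 1) * (6 * k + 3) * (6 * k + 5) * ((3 + 3 * k) * (2 + 3 * k) * (1 + 3 * k) * (suc k * suc k * suc k) * f)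
    falling-six = solve-∀
    regroup : ∀ r t s b w → r * ((3 + t) * (2 + t) * (1 + t) * (s * s * s) * (b * w))
                          ≡ r * b * ((3 + t) * (2 + t) * (1 + t) * (s * s * s) * w)
    regroup = solve-∀

  C-suc-suc-top : ∀ m d → ((2 + m + d) C d) * ((1 + m) * (2 + m)) ≡ (2 + m + d) * (1 + m + d) * ((m + d) C d)
  C-suc-suc-top m d = begin
    ((2 + m + d) C d) * ((1 + m) * (2 + m))       ≡⟨ swap₃ ((2 + m + d) C d) (1 + m) (2 + m) ⟩
    (1 + m) * ((2 + m) * ((2 + m + d) C d))       ≡⟨ cong ((1 + m) *_) (C-suc-top (suc m) d) ⟩
    (1 + m) * ((2 + m + d) * ((1 + m + d) C d))   ≡⟨ swap (1 + m) (2 + m + d) ((1 + m + d) C d) ⟩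
    (2 + m + d) * ((1 + m) * ((1 + m + d) C d))   ≡⟨ cong ((2 + m + d) *_) (C-suc-top m d) ⟩
    (2 + m + d) * ((1 + m + d) * ((m + d) C d))   ≡⟨ *-assoc (2 + m + d) (1 + m + d) ((m + d) C d) ⟨
    (2 + m + d) * (1 + m + d) * ((m + d) C d)     ∎
    where
    swap₃ : ∀ x a b → x * (a * b) ≡ a * (b * x)
    swap₃ = solve-∀
    swap : ∀ a b c → a * (b * c) ≡ b * (a * c)
    swap = solve-∀

  rightCore : ℕ → ℕ → ℕ
  rightCore k d = binom₃ k * ((k + k + d) C d)

  rightCore-sucᵈ : ∀ k d → suc d * rightCore k (suc d) ≡ suc (k + k + d) * rightCore k d
  rightCore-sucᵈ k d = begin
    suc d * (binom₃ k * ((k + k + suc d) C suc d))   ≡⟨ swap (suc d) (binom₃ k) ((k + k + suc d) C suc d) ⟩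
    binom₃ k * (suc d * ((k + k + suc d) C suc d))   ≡⟨ cong (binom₃ k *_) (C-suc-bottom (k + k) d) ⟩
    binom₃ k * ((k + k + suc d) * ((k + k + d) C d)) ≡⟨ cong (λ i → binom₃ k * (i * ((k + k + d) C d))) (+-suc (k + k) d) ⟩
    binom₃ k * (suc (k + k + d) * ((k + k + d) C d)) ≡⟨ swap (binom₃ k) (suc (k + k + d)) ((k + k + d) C d) ⟩
    suc (k + k + d) * rightCore k d                  ∎
    where
    swap : ∀ a b c → a * (b * c) ≡ b * (a * c)
    swap = solve-∀

  rightCore-sucᵏ : ∀ k d → suc k * suc k * suc k * suc k * rightCore (suc k) d
                         ≡ 12 * (6 * k + 1) * (6 * k + 5) * (2 + k + k + d) * suc d * rightCore k (suc d)
  rightCore-sucᵏ k d = *-cancelʳ-≡ _ _ ((1 + m) * (2 + m)) (begin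
    s * s * s * s * (binom₃ s * ((s + s + d) C d)) * ((1 + m) * (2 + m))
      ≡⟨ cong (λ i → s * s * s * s * (binom₃ s * ((i + d) C d)) * ((1 + m) * (2 + m))) (cong suc (+-suc k k)) ⟩
    s * s * s * s * (binom₃ s * ((2 + m + d) C d)) * ((1 + m) * (2 + m))
      ≡⟨ regroupˡ s (binom₃ s) ((2 + m + d) C d) ((1 + m) * (2 + m)) ⟩
    s * (s * s * s * binom₃ s) * (((2 + m + d) C d) * ((1 + m) * (2 + m)))
      ≡⟨ cong₂ (λ u v → s * u * v) (binom₃-suc k) (C-suc-suc-top m d) ⟩
    s * (8 * (6 * k + 1) * (6 * k + 3) * (6 * k + 5) * binom₃ k) * ((2 + m + d) * (1 + m + d) * ((m + d) C d))
      ≡⟨ coefficients k d (binom₃ k) ((m + d) C d) ⟩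
    12 * (6 * k + 1) * (6 * k + 5) * (2 + m + d) * binom₃ k * ((1 + (m + d)) * ((m + d) C d)) * ((1 + m) * (2 + m))
      ≡⟨ cong (λ i → 12 * (6 * k + 1) * (6 * k + 5) * (2 + m + d) * binom₃ k * i * ((1 + m) * (2 + m)))
              (trans (C-suc-bottom m d) (cong (_* ((m + d) C d)) (+-suc m d))) ⟨
    12 * (6 * k + 1) * (6 * k + 5) * (2 + m + d) * binom₃ k * (suc d * ((m + suc d) C suc d)) * ((1 + m) * (2 + m))
      ≡⟨ regroupʳ (12 * (6 * k + 1) * (6 * k + 5) * (2 + m + d)) (suc d) (binom₃ k) ((m + suc d) C suc d) ((1 + m) * (2 + m)) ⟩
    12 * (6 * k + 1) * (6 * k + 5) * (2 + m + d) * suc d * (binom₃ k * ((m + suc d) C suc d)) * ((1 + m) * (2 + m)) ∎)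
    where
    s = suc k
    m = k + k
    regroupˡ : ∀ s b g q → s * s * s * s * (b * g) * q ≡ s * (s * s * s * b) * (g * q)
    regroupˡ = solve-∀
    regroupʳ : ∀ a d b g q → a * b * (d * g) * q ≡ a * d * (b * g) * q
    regroupʳ = solve-∀
    coefficients : ∀ k d b g → suc k * (8 * (6 * k + 1) * (6 * k + 3) * (6 * k + 5) * b) * ((2 + (k + k) + d) * (1 + (k + k) + d) * g)
                             ≡ 12 * (6 * k + 1) * (6 * k + 5) * (2 + (k + k) + d) * b * ((1 + (k + k + d)) * g) * ((1 + (k + k)) * (2 + (k + k)))
    coefficients = solve-∀

open Binomial using (rightCore; rightCore-sucᵈ; rightCore-sucᵏ)

open import Data.Empty using (⊥-elim)
open import Data.Integer as ℤ using (+_)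
import Data.Integer.Properties as ℤ
open import Data.List.Base using (_∷_; [])
open import Data.Maybe.Base using (Maybe; just; nothing)
open import Data.Nat as ℕ using (ℕ; zero; suc; _≤_; _<_; _∸_)
import Data.Nat as N
import Data.Nat.Coprimality as Coprime
open import Data.Nat.Combinatorics using (_C_)
open import Data.Nat.Divisibility using (_∣_; >⇒∤; ∣m+n∣m⇒∣n; m∣m*n)
open import Data.Nat.Properties as ℕ using (<-cmp; m≤n⇒∃[o]m+o≡n; +-suc; m+n∸m≡n)
open import Data.Product using (_×_; _,_; proj₁)
open import Data.Rational using (ℚ; 0ℚ; 1ℚ; _+_; _*_; _-_; -_; _/_; 1/_; ≢-nonZero; mkℚ; ↥_)
open import Data.Rational.Properties
  using ( +-*-commutativeRing; +-0-group; normalize-coprime; 1≢0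
        ; +-identityˡ; +-identityʳ; +-comm; +-inverseʳ
        ; *-zeroˡ; *-zeroʳ; *-identityˡ; *-identityʳ; *-assoc; *-inverseˡ; *-distribˡ-+ )
  renaming (_≟_ to _≟ℚ_)
open import Algebra.Properties.Group +-0-group using (x∙y⁻¹≈ε⇒x≈y)
open import Function.Base using (_∘′_)
open import Level using (0ℓ)
open import Relation.Binary.Definitions using (tri<; tri≈; tri>)
open import Relation.Binary.PropositionalEquality
open import Relation.Nullary using (yes; no)
open import Tactic.RingSolver using (solve; solve-∀)
import Tactic.RingSolver.Core.AlmostCommutativeRing as ACR

open ≡-Reasoning

ℚ-ring : ACR.AlmostCommutativeRing 0ℓ 0ℓ
ℚ-ring = ACR.fromCommutativeRing +-*-commutativeRing isZero
  where
  isZero : ∀ x → Maybe (0ℚ ≡ x)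
  isZero x with x ≟ℚ 0ℚ
  ... | yes x≡0 = just (sym x≡0)
  ... | no _    = nothing

x≢0∧x*y≡0⇒y≡0 : ∀ {x y} → x ≢ 0ℚ → x * y ≡ 0ℚ → y ≡ 0ℚ
x≢0∧x*y≡0⇒y≡0 {x} {y} x≢0 xy≡0 = begin
  y                 ≡⟨ sym (*-identityˡ y) ⟩
  1ℚ * y            ≡⟨ cong (_* y) (sym (*-inverseˡ x)) ⟩
  1/ x * x * y      ≡⟨ *-assoc (1/ x) x y ⟩
  1/ x * (x * y)    ≡⟨ cong (1/ x *_) xy≡0 ⟩
  1/ x * 0ℚ         ≡⟨ *-zeroʳ (1/ x) ⟩
  0ℚ                ∎
  where instance _ = ≢-nonZero x≢0

*-≢0 : ∀ {x y} → x ≢ 0ℚ → y ≢ 0ℚ → x * y ≢ 0ℚ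
*-≢0 x≢0 y≢0 = y≢0 ∘′ x≢0∧x*y≡0⇒y≡0 x≢0

*-cancelˡ-≢0 : ∀ {c x y} → c ≢ 0ℚ → c * x ≡ c * y → x ≡ y
*-cancelˡ-≢0 {c} {x} {y} c≢0 eq = x∙y⁻¹≈ε⇒x≈y x y (x≢0∧x*y≡0⇒y≡0 c≢0 (begin
  c * (x - y)      ≡⟨ distribute c x y ⟩
  c * x - c * y    ≡⟨ cong (_- c * y) eq ⟩
  c * y - c * y    ≡⟨ +-inverseʳ (c * y) ⟩
  0ℚ               ∎))
  where
  distribute : ∀ c x y → c * (x - y) ≡ c * x - c * y
  distribute = solve-∀ ℚ-ring

eq-by-combination : ∀ {D L R a₁ a₂ a₃ a₄ b₁ b₂ b₃ b₄} λ₁ λ₂ λ₃ λ₄ → D ≢ 0ℚ →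
  a₁ ≡ b₁ → a₂ ≡ b₂ → a₃ ≡ b₃ → a₄ ≡ b₄ →
  D * (L - R) ≡ λ₁ * (a₁ - b₁) + λ₂ * (a₂ - b₂) + λ₃ * (a₃ - b₃) + λ₄ * (a₄ - b₄) → L ≡ R
eq-by-combination {D} {L} {R} {a₁} {a₂} {a₃} {a₄} λ₁ λ₂ λ₃ λ₄ D≢0 refl refl refl refl identity =
  x∙y⁻¹≈ε⇒x≈y L R (x≢0∧x*y≡0⇒y≡0 D≢0 (trans identity (vanishes λ₁ λ₂ λ₃ λ₄ a₁ a₂ a₃ a₄)))
  where
  vanishes : ∀ λ₁ λ₂ λ₃ λ₄ a₁ a₂ a₃ a₄ →
    λ₁ * (a₁ - a₁) + λ₂ * (a₂ - a₂) + λ₃ * (a₃ - a₃) + λ₄ * (a₄ - a₄) ≡ 0ℚ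
  vanishes = solve-∀ ℚ-ring

÷'-inverseʳ : ∀ p {q} → q ≢ 0ℚ → (p ÷' q) * q ≡ p
÷'-inverseʳ p {q} q≢0 with q ≟ℚ 0ℚ
... | yes q≡0 = ⊥-elim (q≢0 q≡0)
... | no q≢0′ = begin
  p * 1/ q * q      ≡⟨ *-assoc p (1/ q) q ⟩
  p * (1/ q * q)    ≡⟨ cong (p *_) (*-inverseˡ q) ⟩
  p * 1ℚ            ≡⟨ *-identityʳ p ⟩
  p                 ∎
  where instance _ = ≢-nonZero q≢0′

÷'-unique : ∀ {p q x} → q ≢ 0ℚ → x * q ≡ p → p ÷' q ≡ x
÷'-unique {p} {q} {x} q≢0 xq≡p = x∙y⁻¹≈ε⇒x≈y (p ÷' q) x (x≢0∧x*y≡0⇒y≡0 q≢0 (begin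
  q * (p ÷' q - x)           ≡⟨ distribute q (p ÷' q) x ⟩
  (p ÷' q) * q - x * q       ≡⟨ cong₂ _-_ (÷'-inverseʳ p q≢0) xq≡p ⟩
  p - p                      ≡⟨ +-inverseʳ p ⟩
  0ℚ                         ∎))
  where
  distribute : ∀ q z x → q * (z - x) ≡ z * q - x * q
  distribute = solve-∀ ℚ-ring

÷'-*-÷' : ∀ a b {c d} → c ≢ 0ℚ → d ≢ 0ℚ → (a * b) ÷' (c * d) ≡ (a ÷' c) * (b ÷' d)
÷'-*-÷' a b {c} {d} c≢0 d≢0 = ÷'-unique (*-≢0 c≢0 d≢0) (begin
  (a ÷' c) * (b ÷' d) * (c * d)   ≡⟨ interchange (a ÷' c) (b ÷' d) c d ⟩
  ((a ÷' c) * c) * ((b ÷' d) * d) ≡⟨ cong₂ _*_ (÷'-inverseʳ a c≢0) (÷'-inverseʳ b d≢0) ⟩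
  a * b                           ∎)
  where
  interchange : ∀ x y u v → x * y * (u * v) ≡ (x * u) * (y * v)
  interchange = solve-∀ ℚ-ring

ℕ→ℚ-mkℚ : ∀ m → ℕ→ℚ m ≡ mkℚ (ℤ.+ m) 0 (Coprime.sym (Coprime.1-coprimeTo m))
ℕ→ℚ-mkℚ m = normalize-coprime _

ℕ→ℚ-+ : ∀ m n → ℕ→ℚ (m ℕ.+ n) ≡ ℕ→ℚ m + ℕ→ℚ n
ℕ→ℚ-+ m n rewrite ℕ→ℚ-mkℚ m | ℕ→ℚ-mkℚ n =
  cong (λ z → z / 1) (trans (ℤ.pos-+ m n) (sym (cong₂ ℤ._+_ (ℤ.*-identityʳ (ℤ.+ m)) (ℤ.*-identityʳ (ℤ.+ n)))))

ℕ→ℚ-* : ∀ m n → ℕ→ℚ (m ℕ.* n) ≡ ℕ→ℚ m * ℕ→ℚ n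
ℕ→ℚ-* m n rewrite ℕ→ℚ-mkℚ m | ℕ→ℚ-mkℚ n = cong (λ z → z / 1) (ℤ.pos-* m n)

ℕ→ℚ-suc : ∀ n → ℕ→ℚ (suc n) ≡ ℕ→ℚ n + 1
ℕ→ℚ-suc n = trans (ℕ→ℚ-+ 1 n) (+-comm 1 (ℕ→ℚ n))

ℕ→ℚ-injective : ∀ {m n} → ℕ→ℚ m ≡ ℕ→ℚ n → m ≡ n
ℕ→ℚ-injective {m} {n} eq = ℤ.+-injective (cong ↥_ (trans (sym (ℕ→ℚ-mkℚ m)) (trans eq (ℕ→ℚ-mkℚ n))))

infixl 6 _⊕_
infixl 7 _⊗_

data ℕExpr : Set where
  ⌜_⌝     : ℕ → ℕExpr
  _⊕_ _⊗_ : ℕExpr → ℕExpr → ℕExpr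

⟦_⟧ℕ : ℕExpr → ℕ
⟦ ⌜ m ⌝ ⟧ℕ  = m
⟦ e ⊕ f ⟧ℕ = ⟦ e ⟧ℕ ℕ.+ ⟦ f ⟧ℕ
⟦ e ⊗ f ⟧ℕ = ⟦ e ⟧ℕ ℕ.* ⟦ f ⟧ℕ

⟦_⟧ℚ : ℕExpr → ℚ
⟦ ⌜ m ⌝ ⟧ℚ  = ℕ→ℚ m
⟦ e ⊕ f ⟧ℚ = ⟦ e ⟧ℚ + ⟦ f ⟧ℚ
⟦ e ⊗ f ⟧ℚ = ⟦ e ⟧ℚ * ⟦ f ⟧ℚ

ℕ→ℚ-⟦⟧ : ∀ e → ℕ→ℚ ⟦ e ⟧ℕ ≡ ⟦ e ⟧ℚ
ℕ→ℚ-⟦⟧ ⌜ m ⌝   = refl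
ℕ→ℚ-⟦⟧ (e ⊕ f) = trans (ℕ→ℚ-+ ⟦ e ⟧ℕ ⟦ f ⟧ℕ) (cong₂ _+_ (ℕ→ℚ-⟦⟧ e) (ℕ→ℚ-⟦⟧ f))
ℕ→ℚ-⟦⟧ (e ⊗ f) = trans (ℕ→ℚ-* ⟦ e ⟧ℕ ⟦ f ⟧ℕ) (cong₂ _*_ (ℕ→ℚ-⟦⟧ e) (ℕ→ℚ-⟦⟧ f))

cast-≡ : ∀ e f → ⟦ e ⟧ℕ ≡ ⟦ f ⟧ℕ → ⟦ e ⟧ℚ ≡ ⟦ f ⟧ℚ
cast-≡ e f eq = trans (sym (ℕ→ℚ-⟦⟧ e)) (trans (cong ℕ→ℚ eq) (ℕ→ℚ-⟦⟧ f))

cast-≢0 : ∀ e → ⟦ e ⟧ℕ ≢ 0 → ⟦ e ⟧ℚ ≢ 0ℚ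
cast-≢0 e e≢0 eq = e≢0 (ℕ→ℚ-injective (trans (ℕ→ℚ-⟦⟧ e) eq))

cast-injective : ∀ e f → ⟦ e ⟧ℚ ≡ ⟦ f ⟧ℚ → ⟦ e ⟧ℕ ≡ ⟦ f ⟧ℕ
cast-injective e f eq = ℕ→ℚ-injective (trans (ℕ→ℚ-⟦⟧ e) (trans eq (sym (ℕ→ℚ-⟦⟧ f))))

ℕ→ℚ-suc≢0 : ∀ n → ℕ→ℚ (suc n) ≢ 0ℚ
ℕ→ℚ-suc≢0 n = cast-≢0 ⌜ suc n ⌝ λ ()

ℕ→ℚ-+-suc≢0 : ∀ m n r → ℕ→ℚ m + ℕ→ℚ n + ℕ→ℚ (suc r) ≢ 0ℚ
ℕ→ℚ-+-suc≢0 m n r = cast-≢0 (⌜ m ⌝ ⊕ ⌜ n ⌝ ⊕ ⌜ suc r ⌝) (ℕ.m+1+n≢0 (m ℕ.+ n))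

6m-6n+5≢0 : ∀ m n → 6 * ℕ→ℚ m - 6 * ℕ→ℚ n + 5 ≢ 0ℚ
6m-6n+5≢0 m n eq = >⇒∤ (ℕ.n<1+n 5) (∣m+n∣m⇒∣n (subst (6 ∣_) (sym 6m+5≡6n) (m∣m*n n)) (m∣m*n m))
  where
  rearrange : ∀ M N → 6 * M + 5 ≡ 6 * M - 6 * N + 5 + 6 * N
  rearrange = solve-∀ ℚ-ring
  6m+5≡6n : 6 ℕ.* m ℕ.+ 5 ≡ 6 ℕ.* n
  6m+5≡6n = cast-injective (⌜ 6 ⌝ ⊗ ⌜ m ⌝ ⊕ ⌜ 5 ⌝) (⌜ 6 ⌝ ⊗ ⌜ n ⌝)
    (trans (rearrange (ℕ→ℚ m) (ℕ→ℚ n)) (trans (cong (_+ 6 * ℕ→ℚ n) eq) (+-identityˡ (6 * ℕ→ℚ n))))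

-- Finite sums

sumTo-cong : ∀ n {f g : ℕ → ℚ} → (∀ {k} → k ≤ n → f k ≡ g k) → sumTo n f ≡ sumTo n g
sumTo-cong zero    f≗g = f≗g ℕ.z≤n
sumTo-cong (suc n) f≗g = cong₂ _+_ (sumTo-cong n (f≗g ∘′ ℕ.m≤n⇒m≤1+n)) (f≗g ℕ.≤-refl)

sumTo-+ : ∀ n (f g : ℕ → ℚ) → sumTo n (λ k → f k + g k) ≡ sumTo n f + sumTo n g
sumTo-+ zero    f g = refl
sumTo-+ (suc n) f g = begin
  sumTo n (λ k → f k + g k) + (f (suc n) + g (suc n))   ≡⟨ cong (_+ (f (suc n) + g (suc n))) (sumTo-+ n f g) ⟩
  sumTo n f + sumTo n g + (f (suc n) + g (suc n))       ≡⟨ interchange (sumTo n f) (sumTo n g) (f (suc n)) (g (suc n)) ⟩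
  sumTo n f + f (suc n) + (sumTo n g + g (suc n))       ∎
  where
  interchange : ∀ a b c d → a + b + (c + d) ≡ a + c + (b + d)
  interchange = solve-∀ ℚ-ring

sumTo-*ˡ : ∀ n c (f : ℕ → ℚ) → sumTo n (λ k → c * f k) ≡ c * sumTo n f
sumTo-*ˡ zero    c f = refl
sumTo-*ˡ (suc n) c f = trans (cong (_+ c * f (suc n)) (sumTo-*ˡ n c f)) (sym (*-distribˡ-+ c (sumTo n f) (f (suc n))))

sumTo-telescope : ∀ n (G : ℕ → ℚ) → sumTo n (λ k → G (suc k) - G k) ≡ G (suc n) - G 0
sumTo-telescope zero    G = refl
sumTo-telescope (suc n) G = trans (cong (_+ (G (2 ℕ.+ n) - G (suc n))) (sumTo-telescope n G)) (cancel (G (2 ℕ.+ n)) (G (suc n)) (G 0))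
  where
  cancel : ∀ a b c → b - c + (a - b) ≡ a - c
  cancel = solve-∀ ℚ-ring

sumTo-extendʳ : ∀ n (f : ℕ → ℚ) → f (suc n) ≡ 0ℚ → sumTo (suc n) f ≡ sumTo n f
sumTo-extendʳ n f f≡0 = trans (cong (_+_ (sumTo n f)) f≡0) (+-identityʳ (sumTo n f))

-- The summands of the theorem read n ∸ k, which is 0 for k > n; creative telescoping
-- needs them to vanish there, so they are cut off at k = n.

restrict : (ℕ → ℕ → ℚ) → ℕ → ℕ → ℚ
restrict f n k with k ℕ.≤? n
... | yes _ = f n k
... | no  _ = 0ℚ

restrict-≤ : ∀ f {n k} → k ≤ n → restrict f n k ≡ f n k
restrict-≤ f {n} {k} k≤n with k ℕ.≤? n
... | yes _  = refl
... | no k≰n = ⊥-elim (k≰n k≤n)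

restrict-> : ∀ f {n k} → n < k → restrict f n k ≡ 0ℚ
restrict-> f {n} {k} n<k with k ℕ.≤? n
... | yes k≤n = ⊥-elim (ℕ.<⇒≱ n<k k≤n)
... | no _    = refl

x≡0∧y≡0⇒a*x≡b*y : ∀ a b {x y} → x ≡ 0ℚ → y ≡ 0ℚ → a * x ≡ b * y
x≡0∧y≡0⇒a*x≡b*y a b refl refl = trans (*-zeroʳ a) (sym (*-zeroʳ b))

a≡0∧y≡0⇒a*x≡b*y : ∀ {a} x b {y} → a ≡ 0ℚ → y ≡ 0ℚ → a * x ≡ b * y
a≡0∧y≡0⇒a*x≡b*y x b refl refl = trans (*-zeroˡ x) (sym (*-zeroʳ b))

restrict-shiftₙ : ∀ f (α β : ℚ → ℚ → ℚ) →
  (∀ k d → α (ℕ→ℚ k + ℕ→ℚ d) (ℕ→ℚ k) * f (suc (k ℕ.+ d)) k ≡ β (ℕ→ℚ k + ℕ→ℚ d) (ℕ→ℚ k) * f (k ℕ.+ d) k) →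
  (∀ N → α N (N + 1) ≡ 0ℚ) →
  ∀ n k → α (ℕ→ℚ n) (ℕ→ℚ k) * restrict f (suc n) k ≡ β (ℕ→ℚ n) (ℕ→ℚ k) * restrict f n k
restrict-shiftₙ f α β diagonal boundary n k with <-cmp k (suc n)
... | tri≈ _ refl _ = a≡0∧y≡0⇒a*x≡b*y (restrict f (suc n) (suc n)) (β (ℕ→ℚ n) (ℕ→ℚ (suc n)))
  (trans (cong (α (ℕ→ℚ n)) (ℕ→ℚ-suc n)) (boundary (ℕ→ℚ n))) (restrict-> f (ℕ.n<1+n n))
... | tri> _ _ 1+n<k = x≡0∧y≡0⇒a*x≡b*y (α (ℕ→ℚ n) (ℕ→ℚ k)) (β (ℕ→ℚ n) (ℕ→ℚ k))
  (restrict-> f 1+n<k) (restrict-> f (ℕ.<-trans (ℕ.n<1+n n) 1+n<k))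
... | tri< k<1+n _ _ with m≤n⇒∃[o]m+o≡n (ℕ.s≤s⁻¹ k<1+n)
...   | d , refl = begin
  α (ℕ→ℚ (k ℕ.+ d)) K * restrict f (suc (k ℕ.+ d)) k
    ≡⟨ cong₂ (λ N F → α N K * F) (ℕ→ℚ-+ k d) (restrict-≤ f (ℕ.m≤n⇒m≤1+n (ℕ.m≤m+n k d))) ⟩
  α (K + ℕ→ℚ d) K * f (suc (k ℕ.+ d)) k
    ≡⟨ diagonal k d ⟩
  β (K + ℕ→ℚ d) K * f (k ℕ.+ d) k
    ≡⟨ cong₂ (λ N F → β N K * F) (sym (ℕ→ℚ-+ k d)) (sym (restrict-≤ f (ℕ.m≤m+n k d))) ⟩
  β (ℕ→ℚ (k ℕ.+ d)) K * restrict f (k ℕ.+ d) k ∎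
  where K = ℕ→ℚ k

restrict-shiftₖ : ∀ f (α β : ℚ → ℚ → ℚ) →
  (∀ k d → α (ℕ→ℚ k + 1 + ℕ→ℚ d) (ℕ→ℚ k) * f (suc k ℕ.+ d) (suc k) ≡ β (ℕ→ℚ k + 1 + ℕ→ℚ d) (ℕ→ℚ k) * f (suc k ℕ.+ d) k) →
  (∀ N → β N N ≡ 0ℚ) →
  ∀ n k → α (ℕ→ℚ n) (ℕ→ℚ k) * restrict f n (suc k) ≡ β (ℕ→ℚ n) (ℕ→ℚ k) * restrict f n k
restrict-shiftₖ f α β diagonal boundary n k with <-cmp k n
... | tri≈ _ refl _ = sym (a≡0∧y≡0⇒a*x≡b*y (restrict f k k) (α (ℕ→ℚ k) (ℕ→ℚ k))
  (boundary (ℕ→ℚ k)) (restrict-> f (ℕ.n<1+n k)))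
... | tri> _ _ n<k = x≡0∧y≡0⇒a*x≡b*y (α (ℕ→ℚ n) (ℕ→ℚ k)) (β (ℕ→ℚ n) (ℕ→ℚ k))
  (restrict-> f (ℕ.m<n⇒m<1+n n<k)) (restrict-> f n<k)
... | tri< k<n _ _ with m≤n⇒∃[o]m+o≡n k<n
...   | d , refl = begin
  α (ℕ→ℚ (suc k ℕ.+ d)) K * restrict f (suc k ℕ.+ d) (suc k)
    ≡⟨ cong₂ (λ N F → α N K * F) N≡K+1+D (restrict-≤ f (ℕ.m≤m+n (suc k) d)) ⟩
  α (K + 1 + ℕ→ℚ d) K * f (suc k ℕ.+ d) (suc k)
    ≡⟨ diagonal k d ⟩
  β (K + 1 + ℕ→ℚ d) K * f (suc k ℕ.+ d) k
    ≡⟨ cong₂ (λ N F → β N K * F) (sym N≡K+1+D) (sym (restrict-≤ f (ℕ.m≤n⇒m≤1+n (ℕ.m≤m+n k d)))) ⟩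
  β (ℕ→ℚ (suc k ℕ.+ d)) K * restrict f (suc k ℕ.+ d) k ∎
  where
  K = ℕ→ℚ k
  N≡K+1+D : ℕ→ℚ (suc k ℕ.+ d) ≡ K + 1 + ℕ→ℚ d
  N≡K+1+D = trans (ℕ→ℚ-+ (suc k) d) (cong (_+ ℕ→ℚ d) (ℕ→ℚ-suc k))

-- Recurrences and creative telescoping

module Recurrence (p₀ p₁ p₂ : ℕ → ℚ) where

  Solution : (ℕ → ℚ) → Set
  Solution x = ∀ n → p₀ n * x n + p₁ n * x (suc n) + p₂ n * x (2 ℕ.+ n) ≡ 0ℚ

  solution-unique : (∀ n → p₂ n ≢ 0ℚ) → ∀ {x z} → Solution x → Solution z →
                    x 0 ≡ z 0 → x 1 ≡ z 1 → ∀ n → x n ≡ z n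
  solution-unique p₂≢0 {x} {z} x-solves z-solves x₀≡z₀ x₁≡z₁ n = proj₁ (agree n)
    where
    agree : ∀ n → x n ≡ z n × x (suc n) ≡ z (suc n)
    agree zero    = x₀≡z₀ , x₁≡z₁
    agree (suc n) with agree n
    ... | xₙ≡zₙ , x₁₊ₙ≡z₁₊ₙ = x₁₊ₙ≡z₁₊ₙ , x∙y⁻¹≈ε⇒x≈y _ _ (x≢0∧x*y≡0⇒y≡0 (p₂≢0 n) (begin
      p₂ n * (x (2 ℕ.+ n) - z (2 ℕ.+ n))
        ≡⟨ difference (p₀ n) (p₁ n) (p₂ n) (z n) (z (suc n)) (x (2 ℕ.+ n)) (z (2 ℕ.+ n)) ⟩
      (p₀ n * z n + p₁ n * z (suc n) + p₂ n * x (2 ℕ.+ n)) - (p₀ n * z n + p₁ n * z (suc n) + p₂ n * z (2 ℕ.+ n))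
        ≡⟨ cong₂ (λ u v → (p₀ n * u + p₁ n * v + p₂ n * x (2 ℕ.+ n)) - _) (sym xₙ≡zₙ) (sym x₁₊ₙ≡z₁₊ₙ) ⟩
      (p₀ n * x n + p₁ n * x (suc n) + p₂ n * x (2 ℕ.+ n)) - (p₀ n * z n + p₁ n * z (suc n) + p₂ n * z (2 ℕ.+ n))
        ≡⟨ cong₂ _-_ (x-solves n) (z-solves n) ⟩
      0ℚ - 0ℚ ∎))
      where
      difference : ∀ a b c u v s t → c * (s - t) ≡ (a * u + b * v + c * s) - (a * u + b * v + c * t)
      difference = solve-∀ ℚ-ring

  creative-telescoping : ∀ (F G : ℕ → ℕ → ℚ) → (∀ {n k} → n < k → F n k ≡ 0ℚ) →
    (∀ n → G n 0 ≡ 0ℚ) → (∀ n → G n (3 ℕ.+ n) ≡ 0ℚ) →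
    (∀ n k → p₀ n * F n k + p₁ n * F (suc n) k + p₂ n * F (2 ℕ.+ n) k ≡ G n (suc k) - G n k) →
    Solution (λ n → sumTo n (F n))
  creative-telescoping F G F-vanishes G-start G-end step n = begin
    p₀ n * sumTo n (F n) + p₁ n * sumTo (suc n) (F (suc n)) + p₂ n * sumTo m (F m)
      ≡⟨ cong₂ (λ u v → p₀ n * u + p₁ n * v + p₂ n * sumTo m (F m)) (sym padded₀) (sym padded₁) ⟩
    p₀ n * sumTo m (F n) + p₁ n * sumTo m (F (suc n)) + p₂ n * sumTo m (F m)
      ≡⟨ sym (linear (p₀ n) (p₁ n) (p₂ n) (F n) (F (suc n)) (F m)) ⟩
    sumTo m (λ k → p₀ n * F n k + p₁ n * F (suc n) k + p₂ n * F m k)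
      ≡⟨ sumTo-cong m (λ {k} _ → step n k) ⟩
    sumTo m (λ k → G n (suc k) - G n k)
      ≡⟨ sumTo-telescope m (G n) ⟩
    G n (suc m) - G n 0
      ≡⟨ cong₂ _-_ (G-end n) (G-start n) ⟩
    0ℚ - 0ℚ ∎
    where
    m = 2 ℕ.+ n
    padded₀ : sumTo m (F n) ≡ sumTo n (F n)
    padded₀ = trans (sumTo-extendʳ (suc n) (F n) (F-vanishes (ℕ.m<n⇒m<1+n (ℕ.n<1+n n))))
                    (sumTo-extendʳ n (F n) (F-vanishes (ℕ.n<1+n n)))
    padded₁ : sumTo m (F (suc n)) ≡ sumTo (suc n) (F (suc n))
    padded₁ = sumTo-extendʳ (suc n) (F (suc n)) (F-vanishes (ℕ.n<1+n (suc n)))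
    linear : ∀ a b c f g h → sumTo m (λ k → a * f k + b * g k + c * h k) ≡ a * sumTo m f + b * sumTo m g + c * sumTo m h
    linear a b c f g h = trans (sumTo-+ m _ _)
      (cong₂ _+_ (trans (sumTo-+ m _ _) (cong₂ _+_ (sumTo-*ˡ m a f) (sumTo-*ˡ m b g))) (sumTo-*ˡ m c h))

r₀ r₁ r₂ : ℚ → ℚ
r₀ N = m432 * m432 * ((N + 1) * (N + 1) * (N + 1))
r₁ N = 24 * (2 * N + 3) * (18 * N * N + 54 * N + 49)
r₂ N = (N + 2) * (N + 2) * (N + 2)

open Recurrence (λ n → r₀ (ℕ→ℚ n)) (λ n → r₁ (ℕ→ℚ n)) (λ n → r₂ (ℕ→ℚ n))

r₂≢0 : ∀ n → r₂ (ℕ→ℚ n) ≢ 0ℚ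
r₂≢0 n = *-≢0 (*-≢0 n+2≢0 n+2≢0) n+2≢0
  where n+2≢0 = cast-≢0 (⌜ n ⌝ ⊕ ⌜ 2 ⌝) (ℕ.m+1+n≢0 n)

-- The right-hand side

rightTerm : ℕ → ℕ → ℚ
rightTerm n k = ℕ→ℚ ((6 ℕ.* k) C (3 ℕ.* k)) * ℕ→ℚ ((3 ℕ.* k) C (2 ℕ.* k)) * ℕ→ℚ ((2 ℕ.* k) C k)
                * ℕ→ℚ ((n ℕ.+ k) C (n ∸ k)) * m432 ^ℚ (n ∸ k)

rightTerm-diagonal : ∀ k d → rightTerm (k ℕ.+ d) k ≡ ℕ→ℚ (rightCore k d) * m432 ^ℚ d
rightTerm-diagonal k d = begin
  rightTerm (k ℕ.+ d) k
    ≡⟨ cong₂ (λ t e → c₁ * c₂ * c₃ * ℕ→ℚ (t C e) * m432 ^ℚ e) (top k d) (m+n∸m≡n k d) ⟩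
  c₁ * c₂ * c₃ * ℕ→ℚ ((k ℕ.+ k ℕ.+ d) C d) * m432 ^ℚ d
    ≡⟨ cong (_* m432 ^ℚ d) (ℕ→ℚ-⟦⟧ (⌜ (6 ℕ.* k) C (3 ℕ.* k) ⌝ ⊗ ⌜ (3 ℕ.* k) C (2 ℕ.* k) ⌝ ⊗ ⌜ (2 ℕ.* k) C k ⌝
                                      ⊗ ⌜ (k ℕ.+ k ℕ.+ d) C d ⌝)) ⟨
  ℕ→ℚ (rightCore k d) * m432 ^ℚ d ∎
  where
  c₁ = ℕ→ℚ ((6 ℕ.* k) C (3 ℕ.* k))
  c₂ = ℕ→ℚ ((3 ℕ.* k) C (2 ℕ.* k))
  c₃ = ℕ→ℚ ((2 ℕ.* k) C k)
  top : ∀ k d → k ℕ.+ d ℕ.+ k ≡ k ℕ.+ k ℕ.+ d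
  top k d = trans (ℕ.+-assoc k d k) (trans (cong (k ℕ.+_) (ℕ.+-comm d k)) (sym (ℕ.+-assoc k k d)))

rightSummand : ℕ → ℕ → ℚ
rightSummand = restrict rightTerm

rightSummand-shiftₙ : ∀ n k → let N = ℕ→ℚ n; K = ℕ→ℚ k in
  (N + 1 - K) * rightSummand (suc n) k ≡ m432 * (N + K + 1) * rightSummand n k
rightSummand-shiftₙ = restrict-shiftₙ rightTerm (λ N K → N + 1 - K) (λ N K → m432 * (N + K + 1)) diagonal (λ N → +-inverseʳ (N + 1))
  where
  ratio : ∀ K D c′ c Y → (1 + D) * c′ ≡ (1 + K + K + D) * c →
          (K + D + 1 - K) * (c′ * (m432 * Y)) ≡ m432 * (K + D + K + 1) * (c * Y)
  ratio K D c′ c Y h = begin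
    (K + D + 1 - K) * (c′ * (m432 * Y))  ≡⟨ solve (K ∷ D ∷ c′ ∷ Y ∷ []) ℚ-ring ⟩
    m432 * Y * ((1 + D) * c′)            ≡⟨ cong (m432 * Y *_) h ⟩
    m432 * Y * ((1 + K + K + D) * c)     ≡⟨ solve (K ∷ D ∷ c ∷ Y ∷ []) ℚ-ring ⟩
    m432 * (K + D + K + 1) * (c * Y)     ∎
  diagonal : ∀ k d → let K = ℕ→ℚ k; D = ℕ→ℚ d in
    (K + D + 1 - K) * rightTerm (suc (k ℕ.+ d)) k ≡ m432 * (K + D + K + 1) * rightTerm (k ℕ.+ d) k
  diagonal k d = begin
    α * rightTerm (suc (k ℕ.+ d)) k
      ≡⟨ cong (α *_) (trans (cong (λ n → rightTerm n k) (sym (+-suc k d))) (rightTerm-diagonal k (suc d))) ⟩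
    α * (ℕ→ℚ (rightCore k (suc d)) * (m432 * m432 ^ℚ d))
      ≡⟨ ratio K D _ _ (m432 ^ℚ d) (cast-≡ ((⌜ 1 ⌝ ⊕ ⌜ d ⌝) ⊗ ⌜ rightCore k (suc d) ⌝)
                                           ((⌜ 1 ⌝ ⊕ ⌜ k ⌝ ⊕ ⌜ k ⌝ ⊕ ⌜ d ⌝) ⊗ ⌜ rightCore k d ⌝) (rightCore-sucᵈ k d)) ⟩
    β * (ℕ→ℚ (rightCore k d) * m432 ^ℚ d)
      ≡⟨ cong (β *_) (rightTerm-diagonal k d) ⟨
    β * rightTerm (k ℕ.+ d) k ∎
    where
    K = ℕ→ℚ k
    D = ℕ→ℚ d
    α = K + D + 1 - K
    β = m432 * (K + D + K + 1)

rightSummand-shiftₖ : ∀ n k → let N = ℕ→ℚ n; K = ℕ→ℚ k in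
  m432 * ((K + 1) * (K + 1) * (K + 1) * (K + 1)) * rightSummand n (suc k)
    ≡ 12 * (6 * K + 1) * (6 * K + 5) * (N + K + 1) * (N - K) * rightSummand n k
rightSummand-shiftₖ = restrict-shiftₖ rightTerm
  (λ N K → m432 * ((K + 1) * (K + 1) * (K + 1) * (K + 1)))
  (λ N K → 12 * (6 * K + 1) * (6 * K + 5) * (N + K + 1) * (N - K))
  diagonal boundary
  where
  boundary : ∀ N → 12 * (6 * N + 1) * (6 * N + 5) * (N + N + 1) * (N - N) ≡ 0ℚ
  boundary = solve-∀ ℚ-ring
  ratio : ∀ K D c′ c Y →
          (1 + K) * (1 + K) * (1 + K) * (1 + K) * c′ ≡ 12 * (6 * K + 1) * (6 * K + 5) * (2 + K + K + D) * (1 + D) * c →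
          m432 * ((K + 1) * (K + 1) * (K + 1) * (K + 1)) * (c′ * Y)
            ≡ 12 * (6 * K + 1) * (6 * K + 5) * (K + 1 + D + K + 1) * (K + 1 + D - K) * (c * (m432 * Y))
  ratio K D c′ c Y h = begin
    m432 * ((K + 1) * (K + 1) * (K + 1) * (K + 1)) * (c′ * Y)  ≡⟨ solve (K ∷ c′ ∷ Y ∷ []) ℚ-ring ⟩
    m432 * Y * ((1 + K) * (1 + K) * (1 + K) * (1 + K) * c′)     ≡⟨ cong (m432 * Y *_) h ⟩
    m432 * Y * (12 * (6 * K + 1) * (6 * K + 5) * (2 + K + K + D) * (1 + D) * c)
      ≡⟨ solve (K ∷ D ∷ c ∷ Y ∷ []) ℚ-ring ⟩
    12 * (6 * K + 1) * (6 * K + 5) * (K + 1 + D + K + 1) * (K + 1 + D - K) * (c * (m432 * Y)) ∎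
  diagonal : ∀ k d → let K = ℕ→ℚ k; D = ℕ→ℚ d in
    m432 * ((K + 1) * (K + 1) * (K + 1) * (K + 1)) * rightTerm (suc k ℕ.+ d) (suc k)
      ≡ 12 * (6 * K + 1) * (6 * K + 5) * (K + 1 + D + K + 1) * (K + 1 + D - K) * rightTerm (suc k ℕ.+ d) k
  diagonal k d = begin
    α * rightTerm (suc k ℕ.+ d) (suc k)
      ≡⟨ cong (α *_) (rightTerm-diagonal (suc k) d) ⟩
    α * (ℕ→ℚ (rightCore (suc k) d) * m432 ^ℚ d)
      ≡⟨ ratio K D _ _ (m432 ^ℚ d) (cast-≡ (s ⊗ s ⊗ s ⊗ s ⊗ ⌜ rightCore (suc k) d ⌝)
           (⌜ 12 ⌝ ⊗ (⌜ 6 ⌝ ⊗ ⌜ k ⌝ ⊕ ⌜ 1 ⌝) ⊗ (⌜ 6 ⌝ ⊗ ⌜ k ⌝ ⊕ ⌜ 5 ⌝) ⊗ (⌜ 2 ⌝ ⊕ ⌜ k ⌝ ⊕ ⌜ k ⌝ ⊕ ⌜ d ⌝) ⊗ (⌜ 1 ⌝ ⊕ ⌜ d ⌝)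
              ⊗ ⌜ rightCore k (suc d) ⌝)
           (rightCore-sucᵏ k d)) ⟩
    β * (ℕ→ℚ (rightCore k (suc d)) * (m432 * m432 ^ℚ d))
      ≡⟨ cong (β *_) (trans (cong (λ n → rightTerm n k) (sym (+-suc k d))) (rightTerm-diagonal k (suc d))) ⟨
    β * rightTerm (suc k ℕ.+ d) k ∎
    where
    K = ℕ→ℚ k
    D = ℕ→ℚ d
    s = ⌜ 1 ⌝ ⊕ ⌜ k ⌝
    α = m432 * ((K + 1) * (K + 1) * (K + 1) * (K + 1))
    β = 12 * (6 * K + 1) * (6 * K + 5) * (K + 1 + D + K + 1) * (K + 1 + D - K)

-- The multipliers λᵢ come from eliminating s₀, s₂, t₀, t₁ in turn from D * (lhs - rhs),
-- D = -y (K+1)⁴ (N+K+1) (N+K+2), by the four ratio relations.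
right-telescoping : ∀ N K t₀ t₁ t₂ s₀ s₂ {N₁ N₂ K₁} → N₁ ≡ N + 1 → N₂ ≡ N₁ + 1 → K₁ ≡ K + 1 →
  K₁ ≢ 0ℚ → N + K + 1 ≢ 0ℚ → N₁ + K + 1 ≢ 0ℚ →
  (N + 1 - K) * t₁ ≡ m432 * (N + K + 1) * t₀ →
  (N₁ + 1 - K) * t₂ ≡ m432 * (N₁ + K + 1) * t₁ →
  m432 * ((K + 1) * (K + 1) * (K + 1) * (K + 1)) * s₀ ≡ 12 * (6 * K + 1) * (6 * K + 5) * (N + K + 1) * (N - K) * t₀ →
  m432 * ((K + 1) * (K + 1) * (K + 1) * (K + 1)) * s₂ ≡ 12 * (6 * K + 1) * (6 * K + 5) * (N₂ + K + 1) * (N₂ - K) * t₂ →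
  r₀ N * t₀ + r₁ N * t₁ + r₂ N * t₂ ≡ K₁ * K₁ * K₁ * (m432 * m432 * s₀ - s₂) - K * K * K * (m432 * m432 * t₀ - t₂)
right-telescoping N K t₀ t₁ t₂ s₀ s₂ refl refl refl K₁≢0 N+K+1≢0 N+K+2≢0 h₁ h₂ h₃ h₄ =
  eq-by-combination λ₁ λ₂ λ₃ λ₄ D≢0 h₁ h₂ h₃ h₄ (identity N K t₀ t₁ t₂ s₀ s₂)
  where
  -m432≢0 : - m432 ≢ 0ℚ
  -m432≢0 ()
  D≢0 : - m432 * (K + 1) * (K + 1) * (K + 1) * (K + 1) * (N + K + 1) * (N + 1 + K + 1) ≢ 0ℚ
  D≢0 = *-≢0 (*-≢0 (*-≢0 (*-≢0 (*-≢0 (*-≢0 -m432≢0 K₁≢0) K₁≢0) K₁≢0) K₁≢0) N+K+1≢0) N+K+2≢0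
  K₁³ = (K + 1) * (K + 1) * (K + 1)
  M = 36 * (K + 1) * ((N + 1) * (N + 1) * (N + 1) + K * K * K) + (6 * K + 1) * (6 * K + 5) * (N + K + 1) * (N - K)
  λ₁ = - (12 * m432 * K₁³ * (N + K + 2) * M)
  λ₂ = - (12 * K₁³ * ((N + 1 - K) * M - (K + 1) * (N + K + 1) * (2 * (2 * N + 3) * (18 * N * N + 54 * N + 49))))
  λ₃ = m432 * m432 * K₁³ * (N + K + 1) * (N + K + 2)
  λ₄ = - (K₁³ * (N + K + 1) * (N + K + 2))
  identity : ∀ N K t₀ t₁ t₂ s₀ s₂ →
    let K₁³ = (K + 1) * (K + 1) * (K + 1)
        M   = 36 * (K + 1) * ((N + 1) * (N + 1) * (N + 1) + K * K * K) + (6 * K + 1) * (6 * K + 5) * (N + K + 1) * (N - K)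
    in - m432 * (K + 1) * (K + 1) * (K + 1) * (K + 1) * (N + K + 1) * (N + 1 + K + 1)
         * (m432 * m432 * ((N + 1) * (N + 1) * (N + 1)) * t₀ + 24 * (2 * N + 3) * (18 * N * N + 54 * N + 49) * t₁
            + (N + 2) * (N + 2) * (N + 2) * t₂
            - (K₁³ * (m432 * m432 * s₀ - s₂) - K * K * K * (m432 * m432 * t₀ - t₂)))
       ≡ - (12 * m432 * K₁³ * (N + K + 2) * M) * ((N + 1 - K) * t₁ - m432 * (N + K + 1) * t₀)
         + - (12 * K₁³ * ((N + 1 - K) * M - (K + 1) * (N + K + 1) * (2 * (2 * N + 3) * (18 * N * N + 54 * N + 49))))
             * ((N + 1 + 1 - K) * t₂ - m432 * (N + 1 + K + 1) * t₁)
         + m432 * m432 * K₁³ * (N + K + 1) * (N + K + 2)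
             * (m432 * ((K + 1) * (K + 1) * (K + 1) * (K + 1)) * s₀ - 12 * (6 * K + 1) * (6 * K + 5) * (N + K + 1) * (N - K) * t₀)
         + - (K₁³ * (N + K + 1) * (N + K + 2))
             * (m432 * ((K + 1) * (K + 1) * (K + 1) * (K + 1)) * s₂
                - 12 * (6 * K + 1) * (6 * K + 5) * (N + 1 + 1 + K + 1) * (N + 1 + 1 - K) * t₂)
  identity = solve-∀ ℚ-ring

rightCertificate : ℕ → ℕ → ℚ
rightCertificate n k = ℕ→ℚ k * ℕ→ℚ k * ℕ→ℚ k * (m432 * m432 * rightSummand n k - rightSummand (2 ℕ.+ n) k)

rightSum-solution : Solution (λ n → sumTo n (rightSummand n))
rightSum-solution = creative-telescoping rightSummand rightCertificate (restrict-> rightTerm) start end step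
  where
  start : ∀ n → rightCertificate n 0 ≡ 0ℚ
  start n = *-zeroˡ (m432 * m432 * rightSummand n 0 - rightSummand (2 ℕ.+ n) 0)
  end : ∀ n → rightCertificate n (3 ℕ.+ n) ≡ 0ℚ
  end n = trans (cong₂ (λ u v → K * K * K * (m432 * m432 * u - v))
                       (restrict-> rightTerm (ℕ.m<n⇒m<1+n (ℕ.m<n⇒m<1+n (ℕ.n<1+n n))))
                       (restrict-> rightTerm (ℕ.n<1+n (2 ℕ.+ n))))
                (*-zeroʳ (K * K * K))
    where K = ℕ→ℚ (3 ℕ.+ n)
  step : ∀ n k → r₀ (ℕ→ℚ n) * rightSummand n k + r₁ (ℕ→ℚ n) * rightSummand (suc n) k + r₂ (ℕ→ℚ n) * rightSummand (2 ℕ.+ n) k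
               ≡ rightCertificate n (suc k) - rightCertificate n k
  step n k = right-telescoping (ℕ→ℚ n) (ℕ→ℚ k) _ _ _ _ _ (ℕ→ℚ-suc n) (ℕ→ℚ-suc (suc n)) (ℕ→ℚ-suc k)
    (ℕ→ℚ-suc≢0 k) (ℕ→ℚ-+-suc≢0 n k 0) (ℕ→ℚ-+-suc≢0 (suc n) k 0)
    (rightSummand-shiftₙ n k) (rightSummand-shiftₙ (suc n) k) (rightSummand-shiftₖ n k) (rightSummand-shiftₖ (2 ℕ.+ n) k)

-- The left-hand side

pochRatio : ℚ → ℕ → ℚ
pochRatio α k = poch α k ÷' poch 1ℚ k

poch-one≢0 : ∀ k → poch 1ℚ k ≢ 0ℚ
poch-one≢0 zero    = 1≢0
poch-one≢0 (suc k) = *-≢0 (poch-one≢0 k) (cast-≢0 (⌜ 1 ⌝ ⊕ ⌜ k ⌝) λ ())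

pochRatio-suc : ∀ α k → (ℕ→ℚ k + 1) * pochRatio α (suc k) ≡ (α + ℕ→ℚ k) * pochRatio α k
pochRatio-suc α k = *-cancelˡ-≢0 (poch-one≢0 k) (begin
  p * ((K + 1) * x)          ≡⟨ shuffle₁ p K x ⟩
  x * (p * (1 + K))          ≡⟨ ÷'-inverseʳ (poch α (suc k)) (poch-one≢0 (suc k)) ⟩
  poch α k * (α + K)         ≡⟨ cong (_* (α + K)) (÷'-inverseʳ (poch α k) (poch-one≢0 k)) ⟨
  z * p * (α + K)            ≡⟨ shuffle₂ z p α K ⟩
  p * ((α + K) * z)          ∎)
  where
  p = poch 1ℚ k
  K = ℕ→ℚ k
  x = pochRatio α (suc k)
  z = pochRatio α k
  shuffle₁ : ∀ p K x → p * ((K + 1) * x) ≡ x * (p * (1 + K))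
  shuffle₁ = solve-∀ ℚ-ring
  shuffle₂ : ∀ z p α K → z * p * (α + K) ≡ p * ((α + K) * z)
  shuffle₂ = solve-∀ ℚ-ring

leftTerm : ℕ → ℕ → ℚ
leftTerm n k = ((poch (+ 1 / 6) k * poch (+ 5 / 6) (n ∸ k)) ÷' (poch (+ 1 / 1) k * poch (+ 1 / 1) (n ∸ k))) ^ℚ 2

leftTerm-diagonal : ∀ k d → let a = pochRatio (+ 1 / 6) k; b = pochRatio (+ 5 / 6) d in
  leftTerm (k ℕ.+ d) k ≡ (a * b) * (a * b)
leftTerm-diagonal k d = begin
  leftTerm (k ℕ.+ d) k
    ≡⟨ cong (λ e → ((poch (+ 1 / 6) k * poch (+ 5 / 6) e) ÷' (poch 1ℚ k * poch 1ℚ e)) ^ℚ 2) (m+n∸m≡n k d) ⟩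
  ((poch (+ 1 / 6) k * poch (+ 5 / 6) d) ÷' (poch 1ℚ k * poch 1ℚ d)) ^ℚ 2
    ≡⟨ cong (_^ℚ 2) (÷'-*-÷' (poch (+ 1 / 6) k) (poch (+ 5 / 6) d) (poch-one≢0 k) (poch-one≢0 d)) ⟩
  (a * b) ^ℚ 2
    ≡⟨ cong ((a * b) *_) (*-identityʳ (a * b)) ⟩
  (a * b) * (a * b) ∎
  where
  a = pochRatio (+ 1 / 6) k
  b = pochRatio (+ 5 / 6) d

leftScaledTerm : ℕ → ℕ → ℚ
leftScaledTerm n k = m432 ^ℚ n * leftTerm n k

leftSummand : ℕ → ℕ → ℚ
leftSummand = restrict leftScaledTerm

leftSummand-shiftₙ : ∀ n k → let N = ℕ→ℚ n; K = ℕ→ℚ k in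
  36 * ((N + 1 - K) * (N + 1 - K)) * leftSummand (suc n) k
    ≡ m432 * ((6 * N - 6 * K + 5) * (6 * N - 6 * K + 5)) * leftSummand n k
leftSummand-shiftₙ = restrict-shiftₙ leftScaledTerm
  (λ N K → 36 * ((N + 1 - K) * (N + 1 - K))) (λ N K → m432 * ((6 * N - 6 * K + 5) * (6 * N - 6 * K + 5)))
  diagonal boundary
  where
  boundary : ∀ N → 36 * ((N + 1 - (N + 1)) * (N + 1 - (N + 1))) ≡ 0ℚ
  boundary = solve-∀ ℚ-ring
  ratio : ∀ K D a b′ b Y → (D + 1) * b′ ≡ (+ 5 / 6 + D) * b →
    36 * ((K + D + 1 - K) * (K + D + 1 - K)) * (m432 * Y * ((a * b′) * (a * b′)))
      ≡ m432 * ((6 * (K + D) - 6 * K + 5) * (6 * (K + D) - 6 * K + 5)) * (Y * ((a * b) * (a * b)))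
  ratio K D a b′ b Y h = begin
    36 * ((K + D + 1 - K) * (K + D + 1 - K)) * (m432 * Y * ((a * b′) * (a * b′)))
      ≡⟨ solve (K ∷ D ∷ a ∷ b′ ∷ Y ∷ []) ℚ-ring ⟩
    m432 * Y * (6 * a * ((D + 1) * b′)) * (6 * a * ((D + 1) * b′))
      ≡⟨ cong (λ x → m432 * Y * (6 * a * x) * (6 * a * x)) h ⟩
    m432 * Y * (6 * a * ((+ 5 / 6 + D) * b)) * (6 * a * ((+ 5 / 6 + D) * b))
      ≡⟨ solve (K ∷ D ∷ a ∷ b ∷ Y ∷ []) ℚ-ring ⟩
    m432 * ((6 * (K + D) - 6 * K + 5) * (6 * (K + D) - 6 * K + 5)) * (Y * ((a * b) * (a * b))) ∎
  diagonal : ∀ k d → let K = ℕ→ℚ k; D = ℕ→ℚ d in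
    36 * ((K + D + 1 - K) * (K + D + 1 - K)) * leftScaledTerm (suc (k ℕ.+ d)) k
      ≡ m432 * ((6 * (K + D) - 6 * K + 5) * (6 * (K + D) - 6 * K + 5)) * leftScaledTerm (k ℕ.+ d) k
  diagonal k d = begin
    α * (m432 * Y * leftTerm (suc (k ℕ.+ d)) k)
      ≡⟨ cong (λ x → α * (m432 * Y * x)) (trans (cong (λ n → leftTerm n k) (sym (+-suc k d))) (leftTerm-diagonal k (suc d))) ⟩
    α * (m432 * Y * ((a * b′) * (a * b′)))
      ≡⟨ ratio K D a b′ b Y (pochRatio-suc (+ 5 / 6) d) ⟩
    β * (Y * ((a * b) * (a * b)))
      ≡⟨ cong (λ x → β * (Y * x)) (leftTerm-diagonal k d) ⟨
    β * (Y * leftTerm (k ℕ.+ d) k) ∎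
    where
    K = ℕ→ℚ k
    D = ℕ→ℚ d
    α = 36 * ((K + D + 1 - K) * (K + D + 1 - K))
    β = m432 * ((6 * (K + D) - 6 * K + 5) * (6 * (K + D) - 6 * K + 5))
    Y = m432 ^ℚ (k ℕ.+ d)
    a = pochRatio (+ 1 / 6) k
    b = pochRatio (+ 5 / 6) d
    b′ = pochRatio (+ 5 / 6) (suc d)

leftSummand-shiftₖ : ∀ n k → let N = ℕ→ℚ n; K = ℕ→ℚ k in
  (K + 1) * (K + 1) * ((6 * N - 6 * K - 1) * (6 * N - 6 * K - 1)) * leftSummand n (suc k)
    ≡ (6 * K + 1) * (6 * K + 1) * ((N - K) * (N - K)) * leftSummand n k
leftSummand-shiftₖ = restrict-shiftₖ leftScaledTerm
  (λ N K → (K + 1) * (K + 1) * ((6 * N - 6 * K - 1) * (6 * N - 6 * K - 1)))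
  (λ N K → (6 * K + 1) * (6 * K + 1) * ((N - K) * (N - K)))
  diagonal boundary
  where
  boundary : ∀ N → (6 * N + 1) * (6 * N + 1) * ((N - N) * (N - N)) ≡ 0ℚ
  boundary = solve-∀ ℚ-ring
  ratio : ∀ K D a′ a b′ b Y → (K + 1) * a′ ≡ (+ 1 / 6 + K) * a → (D + 1) * b′ ≡ (+ 5 / 6 + D) * b →
    (K + 1) * (K + 1) * ((6 * (K + 1 + D) - 6 * K - 1) * (6 * (K + 1 + D) - 6 * K - 1)) * (Y * ((a′ * b) * (a′ * b)))
      ≡ (6 * K + 1) * (6 * K + 1) * ((K + 1 + D - K) * (K + 1 + D - K)) * (Y * ((a * b′) * (a * b′)))
  ratio K D a′ a b′ b Y hₐ h_b = begin
    (K + 1) * (K + 1) * ((6 * (K + 1 + D) - 6 * K - 1) * (6 * (K + 1 + D) - 6 * K - 1)) * (Y * ((a′ * b) * (a′ * b)))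
      ≡⟨ solve (K ∷ D ∷ a′ ∷ b ∷ Y ∷ []) ℚ-ring ⟩
    Y * ((K + 1) * a′ * ((6 * D + 5) * b)) * ((K + 1) * a′ * ((6 * D + 5) * b))
      ≡⟨ cong (λ x → Y * (x * ((6 * D + 5) * b)) * (x * ((6 * D + 5) * b))) hₐ ⟩
    Y * ((+ 1 / 6 + K) * a * ((6 * D + 5) * b)) * ((+ 1 / 6 + K) * a * ((6 * D + 5) * b))
      ≡⟨ solve (K ∷ D ∷ a ∷ b ∷ Y ∷ []) ℚ-ring ⟩
    Y * ((6 * K + 1) * a * ((+ 5 / 6 + D) * b)) * ((6 * K + 1) * a * ((+ 5 / 6 + D) * b))
      ≡⟨ cong (λ x → Y * ((6 * K + 1) * a * x) * ((6 * K + 1) * a * x)) h_b ⟨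
    Y * ((6 * K + 1) * a * ((D + 1) * b′)) * ((6 * K + 1) * a * ((D + 1) * b′))
      ≡⟨ solve (K ∷ D ∷ a ∷ b′ ∷ Y ∷ []) ℚ-ring ⟩
    (6 * K + 1) * (6 * K + 1) * ((K + 1 + D - K) * (K + 1 + D - K)) * (Y * ((a * b′) * (a * b′))) ∎
  diagonal : ∀ k d → let K = ℕ→ℚ k; D = ℕ→ℚ d in
    (K + 1) * (K + 1) * ((6 * (K + 1 + D) - 6 * K - 1) * (6 * (K + 1 + D) - 6 * K - 1)) * leftScaledTerm (suc k ℕ.+ d) (suc k)
      ≡ (6 * K + 1) * (6 * K + 1) * ((K + 1 + D - K) * (K + 1 + D - K)) * leftScaledTerm (suc k ℕ.+ d) k
  diagonal k d = begin
    α * (Y * leftTerm (suc k ℕ.+ d) (suc k))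
      ≡⟨ cong (λ x → α * (Y * x)) (leftTerm-diagonal (suc k) d) ⟩
    α * (Y * ((a′ * b) * (a′ * b)))
      ≡⟨ ratio K D a′ a b′ b Y (pochRatio-suc (+ 1 / 6) k) (pochRatio-suc (+ 5 / 6) d) ⟩
    β * (Y * ((a * b′) * (a * b′)))
      ≡⟨ cong (λ x → β * (Y * x)) (trans (cong (λ n → leftTerm n k) (sym (+-suc k d))) (leftTerm-diagonal k (suc d))) ⟨
    β * (Y * leftTerm (suc k ℕ.+ d) k) ∎
    where
    K = ℕ→ℚ k
    D = ℕ→ℚ d
    α = (K + 1) * (K + 1) * ((6 * (K + 1 + D) - 6 * K - 1) * (6 * (K + 1 + D) - 6 * K - 1))
    β = (6 * K + 1) * (6 * K + 1) * ((K + 1 + D - K) * (K + 1 + D - K))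
    Y = m432 ^ℚ (suc k ℕ.+ d)
    a′ = pochRatio (+ 1 / 6) (suc k)
    a = pochRatio (+ 1 / 6) k
    b′ = pochRatio (+ 5 / 6) (suc d)
    b = pochRatio (+ 5 / 6) d

-- As for right-telescoping, with D = 18 (6N-6K+5)² (6N-6K+11)², eliminating v₁, v₂, u₀, u₁.
left-telescoping : ∀ N K u₀ u₁ u₂ v₁ v₂ {N₁ N₂ K₁} → N₁ ≡ N + 1 → N₂ ≡ N₁ + 1 → K₁ ≡ K + 1 →
  6 * N - 6 * K + 5 ≢ 0ℚ → 6 * N₁ - 6 * K + 5 ≢ 0ℚ →
  36 * ((N + 1 - K) * (N + 1 - K)) * u₁ ≡ m432 * ((6 * N - 6 * K + 5) * (6 * N - 6 * K + 5)) * u₀ →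
  36 * ((N₁ + 1 - K) * (N₁ + 1 - K)) * u₂ ≡ m432 * ((6 * N₁ - 6 * K + 5) * (6 * N₁ - 6 * K + 5)) * u₁ →
  (K + 1) * (K + 1) * ((6 * N₁ - 6 * K - 1) * (6 * N₁ - 6 * K - 1)) * v₁ ≡ (6 * K + 1) * (6 * K + 1) * ((N₁ - K) * (N₁ - K)) * u₁ →
  (K + 1) * (K + 1) * ((6 * N₂ - 6 * K - 1) * (6 * N₂ - 6 * K - 1)) * v₂ ≡ (6 * K + 1) * (6 * K + 1) * ((N₂ - K) * (N₂ - K)) * u₂ →
  r₀ N * u₀ + r₁ N * u₁ + r₂ N * u₂
    ≡ K₁ * K₁ * ((2 * K₁ - 3 * N - 6) * v₂ - 144 * (9 * N - 6 * K₁ + 14) * v₁)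
      - K * K * ((2 * K - 3 * N - 6) * u₂ - 144 * (9 * N - 6 * K + 14) * u₁)
left-telescoping N K u₀ u₁ u₂ v₁ v₂ refl refl refl e₅≢0 e₁₁≢0 h₁ h₂ h₃ h₄ =
  eq-by-combination λ₁ λ₂ λ₃ λ₄ D≢0 h₁ h₂ h₃ h₄ (identity N K u₀ u₁ u₂ v₁ v₂)
  where
  e₅ = 6 * N - 6 * K + 5
  e₁₁ = 6 * (N + 1) - 6 * K + 5
  18≢0 : 18 ≢ 0ℚ
  18≢0 ()
  D≢0 : 18 * (e₅ * e₅) * (e₁₁ * e₁₁) ≢ 0ℚ
  D≢0 = *-≢0 (*-≢0 18≢0 (*-≢0 e₅≢0 e₅≢0)) (*-≢0 e₁₁≢0 e₁₁≢0)
  λ₁ = 7776 * ((N + 1) * (N + 1) * (N + 1)) * (e₁₁ * e₁₁)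
  λ₂ = e₅ * e₅ * ((2 * N + 3) * (18 * N * N + 54 * N + 49) - 6 * K * K * (9 * N - 6 * K + 14))
       + 6 * (9 * N - 6 * K + 8) * ((6 * K + 1) * (6 * K + 1)) * ((N + 1 - K) * (N + 1 - K))
       - 648 * ((N + 1) * (N + 1) * (N + 1)) * ((N + 1 - K) * (N + 1 - K))
  λ₃ = 2592 * (9 * N - 6 * K + 8) * (e₁₁ * e₁₁)
  λ₄ = 18 * (3 * N - 2 * K + 4) * (e₅ * e₅)
  identity : ∀ N K u₀ u₁ u₂ v₁ v₂ →
    let e₅  = 6 * N - 6 * K + 5
        e₁₁ = 6 * (N + 1) - 6 * K + 5
    in 18 * (e₅ * e₅) * (e₁₁ * e₁₁)
         * (m432 * m432 * ((N + 1) * (N + 1) * (N + 1)) * u₀ + 24 * (2 * N + 3) * (18 * N * N + 54 * N + 49) * u₁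
            + (N + 2) * (N + 2) * (N + 2) * u₂
            - ((K + 1) * (K + 1) * ((2 * (K + 1) - 3 * N - 6) * v₂ - 144 * (9 * N - 6 * (K + 1) + 14) * v₁)
               - K * K * ((2 * K - 3 * N - 6) * u₂ - 144 * (9 * N - 6 * K + 14) * u₁)))
       ≡ 7776 * ((N + 1) * (N + 1) * (N + 1)) * (e₁₁ * e₁₁)
           * (36 * ((N + 1 - K) * (N + 1 - K)) * u₁ - m432 * (e₅ * e₅) * u₀)
         + (e₅ * e₅ * ((2 * N + 3) * (18 * N * N + 54 * N + 49) - 6 * K * K * (9 * N - 6 * K + 14))
            + 6 * (9 * N - 6 * K + 8) * ((6 * K + 1) * (6 * K + 1)) * ((N + 1 - K) * (N + 1 - K))
            - 648 * ((N + 1) * (N + 1) * (N + 1)) * ((N + 1 - K) * (N + 1 - K)))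
           * (36 * ((N + 1 + 1 - K) * (N + 1 + 1 - K)) * u₂ - m432 * (e₁₁ * e₁₁) * u₁)
         + 2592 * (9 * N - 6 * K + 8) * (e₁₁ * e₁₁)
           * ((K + 1) * (K + 1) * ((6 * (N + 1) - 6 * K - 1) * (6 * (N + 1) - 6 * K - 1)) * v₁
              - (6 * K + 1) * (6 * K + 1) * ((N + 1 - K) * (N + 1 - K)) * u₁)
         + 18 * (3 * N - 2 * K + 4) * (e₅ * e₅)
           * ((K + 1) * (K + 1) * ((6 * (N + 1 + 1) - 6 * K - 1) * (6 * (N + 1 + 1) - 6 * K - 1)) * v₂
              - (6 * K + 1) * (6 * K + 1) * ((N + 1 + 1 - K) * (N + 1 + 1 - K)) * u₂)
  identity = solve-∀ ℚ-ring

leftCertificate : ℕ → ℕ → ℚ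
leftCertificate n k = let N = ℕ→ℚ n; K = ℕ→ℚ k in
  K * K * ((2 * K - 3 * N - 6) * leftSummand (2 ℕ.+ n) k - 144 * (9 * N - 6 * K + 14) * leftSummand (suc n) k)

leftSum-solution : Solution (λ n → sumTo n (leftSummand n))
leftSum-solution = creative-telescoping leftSummand leftCertificate (restrict-> leftScaledTerm) start end step
  where
  start : ∀ n → leftCertificate n 0 ≡ 0ℚ
  start n = *-zeroˡ ((2 * 0ℚ - 3 * ℕ→ℚ n - 6) * leftSummand (2 ℕ.+ n) 0 - 144 * (9 * ℕ→ℚ n - 6 * 0ℚ + 14) * leftSummand (suc n) 0)
  vanish : ∀ K N → K * K * ((2 * K - 3 * N - 6) * 0ℚ - 144 * (9 * N - 6 * K + 14) * 0ℚ) ≡ 0ℚ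
  vanish = solve-∀ ℚ-ring
  end : ∀ n → leftCertificate n (3 ℕ.+ n) ≡ 0ℚ
  end n = trans (cong₂ (λ u v → K * K * ((2 * K - 3 * ℕ→ℚ n - 6) * u - 144 * (9 * ℕ→ℚ n - 6 * K + 14) * v))
                       (restrict-> leftScaledTerm (ℕ.n<1+n (2 ℕ.+ n)))
                       (restrict-> leftScaledTerm (ℕ.m<n⇒m<1+n (ℕ.n<1+n (suc n)))))
                (vanish K (ℕ→ℚ n))
    where K = ℕ→ℚ (3 ℕ.+ n)
  step : ∀ n k → r₀ (ℕ→ℚ n) * leftSummand n k + r₁ (ℕ→ℚ n) * leftSummand (suc n) k + r₂ (ℕ→ℚ n) * leftSummand (2 ℕ.+ n) k
               ≡ leftCertificate n (suc k) - leftCertificate n k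
  step n k = left-telescoping (ℕ→ℚ n) (ℕ→ℚ k) _ _ _ _ _ (ℕ→ℚ-suc n) (ℕ→ℚ-suc (suc n)) (ℕ→ℚ-suc k)
    (6m-6n+5≢0 n k) (6m-6n+5≢0 (suc n) k)
    (leftSummand-shiftₙ n k) (leftSummand-shiftₙ (suc n) k) (leftSummand-shiftₖ (suc n) k) (leftSummand-shiftₖ (2 ℕ.+ n) k)

mainTheorem5 : (n : ℕ) →
    m432 ^ℚ n * sumTo n (λ k →
        ((poch (+ 1 / 6) k * poch (+ 5 / 6) (n ∸ k))
          ÷' (poch (+ 1 / 1) k * poch (+ 1 / 1) (n ∸ k))) ^ℚ 2)
    ≡ sumTo n (λ k →
        ℕ→ℚ ((6 N.* k) C (3 N.* k)) * ℕ→ℚ ((3 N.* k) C (2 N.* k)) * ℕ→ℚ ((2 N.* k) C k)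
          * ℕ→ℚ ((n N.+ k) C (n ∸ k)) * m432 ^ℚ (n ∸ k))
mainTheorem5 n = begin
  m432 ^ℚ n * sumTo n (leftTerm n)   ≡⟨ sumTo-*ˡ n (m432 ^ℚ n) (leftTerm n) ⟨
  sumTo n (leftScaledTerm n)         ≡⟨ sumTo-cong n (λ k≤n → sym (restrict-≤ leftScaledTerm k≤n)) ⟩
  sumTo n (leftSummand n)            ≡⟨ solution-unique r₂≢0 leftSum-solution rightSum-solution refl refl n ⟩
  sumTo n (rightSummand n)           ≡⟨ sumTo-cong n (restrict-≤ rightTerm) ⟩
  sumTo n (rightTerm n)              ∎
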